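{- For any two connected graphs $G_1$ and $G_2$, $$\chi_d^t(G_1\star G_2)\leq |V(G_1)|+|V(G_2)|.$$
   Context: All graphs are simple and finite. A total dominator coloring (TD-coloring) of a graph $G$ with no isolated vertex is a proper vertex coloring of $G$ in which every vertex of $G$ is adjacent to every vertex of some (other) color class. The total dominator chromatic number $\chi_d^t(G)$ is the minimum number of color classes in a TD-coloring of $G$. The neighbourhood corona $G_1\star G_2$ is the graph obtained by taking one copy of $G_1$ and $|V(G_1)|$ copies of $G_2$, and joining every neighbour (in $G_1$) of the $i$th vertex of $G_1$ to every vertex in the $i$th copy of $G_2$. -}

module Defs where

open import Data.Nat using (ℕ; _≤_)
open import Data.Fin using (Fin; _≟_)
open import Data.Bool using (Bool; true; false; _∧_)
open import Data.Sum using (_⊎_; inj₁; inj₂)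
open import Data.Product using (_×_; _,_; Σ; ∃; ∃-syntax)
open import Relation.Nullary using (¬_; does)
open import Relation.Binary.PropositionalEquality using (_≡_; _≢_)

record SimpleGraph (n : ℕ) : Set where
  field
    adj    : Fin n → Fin n → Bool
    sym    : ∀ u v → adj u v ≡ adj v u
    irrefl : ∀ v → adj v v ≡ false

open SimpleGraph public

Adj : ∀ {n} → SimpleGraph n → Fin n → Fin n → Set
Adj G u v = adj G u v ≡ true

data Reachable {n : ℕ} (G : SimpleGraph n) : Fin n → Fin n → Set where
  here : ∀ {v} → Reachable G v v
  step : ∀ {u v w} → Adj G u v → Reachable G v w → Reachable G u w

Connected : ∀ {n} → SimpleGraph n → Set
Connected {n} G = Fin n × (∀ u v → Reachable G u v)

-- Neighbourhood corona G1 ⋆ G2: vertices are inj₁ i (the copy of G1) and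
-- inj₂ (i , x) (vertex x of the i-th copy of G2).
CoronaV : ℕ → ℕ → Set
CoronaV n₁ n₂ = Fin n₁ ⊎ (Fin n₁ × Fin n₂)

coronaAdj : ∀ {n₁ n₂} → SimpleGraph n₁ → SimpleGraph n₂ →
            CoronaV n₁ n₂ → CoronaV n₁ n₂ → Bool
coronaAdj G₁ G₂ (inj₁ i)       (inj₁ j)       = adj G₁ i j
coronaAdj G₁ G₂ (inj₁ j)       (inj₂ (i , x)) = adj G₁ i j
coronaAdj G₁ G₂ (inj₂ (i , x)) (inj₁ j)       = adj G₁ i j
coronaAdj G₁ G₂ (inj₂ (i , x)) (inj₂ (j , y)) = does (i ≟ j) ∧ adj G₂ x y

CoronaAdj : ∀ {n₁ n₂} → SimpleGraph n₁ → SimpleGraph n₂ →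
            CoronaV n₁ n₂ → CoronaV n₁ n₂ → Set
CoronaAdj G₁ G₂ u v = coronaAdj G₁ G₂ u v ≡ true

IsTDColoring : {V : Set} (E : V → V → Set) (k : ℕ) (c : V → Fin k) → Set
IsTDColoring {V} E k c =
  (∀ u v → E u v → c u ≢ c v) ×
  (∀ v → ∃[ i ] ((∃[ u ] c u ≡ i) × (∀ u → c u ≡ i → E v u)))

χdt≤ : {V : Set} (E : V → V → Set) (k : ℕ) → Set
χdt≤ E k = ∃[ c ] IsTDColoring E k c

-- Give the i-th vertex of G₁ its own colour i, and every vertex x of every
-- copy of G₂ the colour x. Vertices of G₁ are then singleton classes, and a
-- vertex of G₁ ⋆ G₂ whose base vertex in G₁ is i is adjacent to every
-- G₁-neighbour of i; since G₁ is connected with at least two vertices, such a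
-- neighbour exists, and its singleton class totally dominates the vertex.
-- Properness holds because copies of the same vertex of G₂ are never adjacent.
module Submission where

open import Defs hiding (sym)
open import Data.Nat using (ℕ; _+_; _≤_; s≤s)
open import Data.Fin using (Fin; join; splitAt; _≟_; punchIn; zero)
open import Data.Fin.Properties using (splitAt-join; punchInᵢ≢i)
open import Data.Sum using (_⊎_; inj₁; inj₂)
import Data.Sum as Sum
open import Data.Product using (_×_; _,_; proj₂; ∃-syntax)
open import Data.Bool.Properties using (∧-zeroʳ)
open import Data.Empty using (⊥-elim)
open import Function using (_∘_)
open import Function.Definitions using (Injective)
open import Relation.Nullary using (¬_; does)
open import Relation.Binary.PropositionalEquality
  using (_≡_; _≢_; refl; sym; trans; cong)

module _ {n : ℕ} (G : SimpleGraph n) where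

  NoIsolatedVertex : Set
  NoIsolatedVertex = ∀ v → ∃[ u ] Adj G v u

  ¬Adj-refl : ∀ v → ¬ Adj G v v
  ¬Adj-refl v a with trans (sym (irrefl G v)) a
  ... | ()

  Reachable-distinct⇒neighbour : ∀ {v w} → w ≢ v → Reachable G v w → ∃[ u ] Adj G v u
  Reachable-distinct⇒neighbour w≢v here = ⊥-elim (w≢v refl)
  Reachable-distinct⇒neighbour _ (step {v = u} a _) = u , a

  connected⇒noIsolatedVertex : 2 ≤ n → Connected G → NoIsolatedVertex
  connected⇒noIsolatedVertex (s≤s (s≤s _)) (_ , reach) v =
    Reachable-distinct⇒neighbour (punchInᵢ≢i v zero) (reach v (punchIn v zero))

IsTDColouring : {V C : Set} (E : V → V → Set) (c : V → C) → Set
IsTDColouring E c =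
  (∀ u v → E u v → c u ≢ c v) ×
  (∀ v → ∃[ i ] ((∃[ u ] c u ≡ i) × (∀ u → c u ≡ i → E v u)))

IsTDColouring-injective : {V C D : Set} {E : V → V → Set} {c : V → C} {f : C → D} →
  Injective _≡_ _≡_ f → IsTDColouring E c → IsTDColouring E (f ∘ c)
IsTDColouring-injective {f = f} f-inj (proper , dominating) =
  (λ u v a → proper u v a ∘ f-inj) ,
  λ v → let (i , (w , cw≡i) , dom) = dominating v in
        f i , (w , cong f cw≡i) , λ u fcu≡fi → dom u (f-inj fcu≡fi)

join-injective : ∀ m n → Injective _≡_ _≡_ (join m n)
join-injective m n {i} {j} eq =
  trans (sym (splitAt-join m n i)) (trans (cong (splitAt m) eq) (splitAt-join m n j))

module _ {n₁ n₂ : ℕ} (G₁ : SimpleGraph n₁) (G₂ : SimpleGraph n₂) where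

  base : CoronaV n₁ n₂ → Fin n₁
  base (inj₁ i)       = i
  base (inj₂ (i , _)) = i

  CoronaAdj-base : ∀ v {k} → Adj G₁ (base v) k → CoronaAdj G₁ G₂ v (inj₁ k)
  CoronaAdj-base (inj₁ _) a = a
  CoronaAdj-base (inj₂ _) a = a

  ¬CoronaAdj-copies : ∀ i j x → ¬ CoronaAdj G₁ G₂ (inj₂ (i , x)) (inj₂ (j , x))
  ¬CoronaAdj-copies i j x a rewrite irrefl G₂ x | ∧-zeroʳ (does (i ≟ j)) with a
  ... | ()

  colouring : CoronaV n₁ n₂ → Fin n₁ ⊎ Fin n₂
  colouring = Sum.map₂ proj₂

  colouring-proper : ∀ u v → CoronaAdj G₁ G₂ u v → colouring u ≢ colouring v
  colouring-proper (inj₁ i)       (inj₁ .i)       a refl = ¬Adj-refl G₁ i a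
  colouring-proper (inj₂ (i , x)) (inj₂ (j , .x)) a refl = ¬CoronaAdj-copies i j x a

  colouring-isTDColouring : NoIsolatedVertex G₁ → IsTDColouring (CoronaAdj G₁ G₂) colouring
  colouring-isTDColouring neighbour = colouring-proper , dominated
    where
    dominated : ∀ v → ∃[ i ] ((∃[ u ] colouring u ≡ i) × (∀ u → colouring u ≡ i → CoronaAdj G₁ G₂ v u))
    dominated v = let (k , a) = neighbour (base v) in
      inj₁ k , (inj₁ k , refl) , λ { (inj₁ .k) refl → CoronaAdj-base v a }

theorem2p1 : (n₁ n₂ : ℕ) (G₁ : SimpleGraph n₁) (G₂ : SimpleGraph n₂) →
    2 ≤ n₁ → Connected G₁ → Connected G₂ →
    χdt≤ (CoronaAdj G₁ G₂) (n₁ + n₂)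
theorem2p1 n₁ n₂ G₁ G₂ 2≤n₁ G₁-connected _ =
  join n₁ n₂ ∘ colouring G₁ G₂ ,
  IsTDColouring-injective (join-injective n₁ n₂)
    (colouring-isTDColouring G₁ G₂ (connected⇒noIsolatedVertex G₁ 2≤n₁ G₁-connected))
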